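{- For every $n\ge1$ and every oriented edge $e=(\lambda,\mu)$ of $G_n$, if $J(e)=(u,v,w)$ then $w\in\{ -2,-1,0,1,2\}$; equivalently $|w|\le2$.
   Context: $\mathrm{Par}(n)$ is the set of integer partitions of $n$. The partition graph $G_n$ has vertex set $\mathrm{Par}(n)$, with $\lambda\sim\mu$ iff $\mu\ne\lambda$ and $\mu$ is obtained from $\lambda$ by moving one unit from one part to another part (possibly a newly created part), omitting zero parts and reordering. $d(\lambda)$ is the degree in $G_n$; $\delta(\lambda)$ is the maximum dimension of a simplex of the clique complex of $G_n$ containing $\lambda$; $\sigma(\lambda)$ is the number of distinct part sizes of $\lambda$. The jump signature of $e=(\lambda,\mu)$ is $J(e)=(d(\mu)-d(\lambda),\ \delta(\mu)-\delta(\lambda),\ \sigma(\mu)-\sigma(\lambda))$. -}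

module Defs where

open import Data.Nat using (ℕ; zero; suc; _≥_; _∸_; _+_; _≟_)
open import Data.List using (List; []; _∷_; length; deduplicate)
open import Data.Nat.ListAction using (sum)
open import Data.List.Relation.Unary.All using (All)
open import Data.List.Relation.Unary.Linked using (Linked)
open import Data.List.Relation.Binary.Permutation.Propositional using (_↭_)
open import Data.Product using (Σ; _×_; ∃)
open import Data.Sum using (_⊎_)
open import Relation.Binary.PropositionalEquality using (_≡_; _≢_)

Pos : ℕ → Set
Pos n = n ≥ 1

record Partition (n : ℕ) : Set where
  constructor mkPartition
  field
    parts   : List ℕ
    decr    : Linked _≥_ parts
    pos     : All Pos parts
    sumIs   : sum parts ≡ n
open Partition public

dropZeros : List ℕ → List ℕ
dropZeros []          = []
dropZeros (zero ∷ xs) = dropZeros xs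
dropZeros (suc x ∷ xs) = suc x ∷ dropZeros xs

data Move (xs ys : List ℕ) : Set where
  toExisting : (a b : ℕ) (rest : List ℕ) →
               xs ↭ (a ∷ b ∷ rest) →
               ys ↭ dropZeros ((a ∸ 1) ∷ (b + 1) ∷ rest) →
               Move xs ys
  toNew      : (a : ℕ) (rest : List ℕ) →
               xs ↭ (a ∷ rest) →
               ys ↭ dropZeros ((a ∸ 1) ∷ 1 ∷ rest) →
               Move xs ys

Adj : {n : ℕ} → Partition n → Partition n → Set
Adj l m = (parts m ≢ parts l) × Move (parts l) (parts m)

σ : {n : ℕ} → Partition n → ℕ
σ l = length (deduplicate _≟_ (parts l))

{-# OPTIONS --safe #-}
-- A move changes at most two parts: both λ and μ consist of a common multiset R of
-- parts together with at most two further parts (zeros dropped). Adding one entry to a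
-- list raises its number of distinct values by 0 or 1, so σ λ and σ μ both lie in
-- [σ R, σ R + 2], and hence differ by at most 2.
module Submission where

open import Defs
open import Data.Nat using (ℕ; _≤_; _≥_)
open import Data.Integer using (ℤ; +_; _-_; ∣_∣)

open import Level using (Level)
open import Data.Nat using (zero; suc; _+_; _∸_; _≟_; z≤n; s≤s)
open import Data.Nat.Properties using (≤-refl; ≤-total; ≤-trans; +-monoˡ-≤; ≤-antisym; ≤-reflexive; m≤n⇒m≤1+n; ∸-mono; m+n∸n≡m; module ≤-Reasoning)
open import Data.Integer.Properties using ([+m]-[+n]≡m⊖n; ∣m⊖n∣≡∣n⊖m∣; ∣⊖∣-≤)
open import Data.List using (List; []; _∷_; [_]; _++_; length; deduplicate)
open import Data.List.Properties using (length-filter)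
open import Data.List.Relation.Unary.Any using (here; there)
open import Data.List.Relation.Unary.All using (All; []; _∷_)
open import Data.List.Relation.Unary.All.Properties using (All¬⇒¬Any; ++⁻ʳ)
open import Data.List.Relation.Unary.AllPairs using (_∷_)
open import Data.List.Relation.Unary.Unique.Propositional using (Unique)
open import Data.List.Relation.Unary.Unique.DecPropositional.Properties using (deduplicate-!)
open import Data.List.Membership.Propositional.Properties using (deduplicate-∈⇔; ∈-∃++)
open import Data.List.Relation.Binary.Subset.Propositional using (_⊆_)
open import Data.List.Relation.Binary.Subset.Propositional.Properties using (⊆∷∧∉⇒⊆; ⊆-respʳ-↭; ⊆-reflexive-↭; xs⊆ys++xs)
open import Data.List.Relation.Binary.Permutation.Propositional using (_↭_; ↭-sym)
open import Data.List.Relation.Binary.Permutation.Propositional.Properties using (↭-length; shift; All-resp-↭)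
open import Data.Product using (_×_; _,_)
open import Data.Sum using (inj₁; inj₂)
open import Function using (_∘_)
open import Function.Bundles using (Equivalence)
open import Relation.Binary.Definitions using (DecidableEquality)
open import Relation.Binary.PropositionalEquality using (_≡_; refl; sym; trans; cong; subst; module ≡-Reasoning)

private
  variable
    a : Level
    A : Set a

unique∧⊆⇒length≤ : {xs ys : List A} → Unique xs → xs ⊆ ys → length xs ≤ length ys
unique∧⊆⇒length≤ {xs = []} _ _ = z≤n
unique∧⊆⇒length≤ {xs = x ∷ xs} (x∉xs ∷ !xs) x∷xs⊆ys
  with as , bs , refl ← ∈-∃++ (x∷xs⊆ys (here refl)) = begin
    suc (length xs)          ≤⟨ s≤s (unique∧⊆⇒length≤ !xs xs⊆as++bs) ⟩
    suc (length (as ++ bs))  ≡⟨ ↭-length (shift x as bs) ⟨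
    length (as ++ [ x ] ++ bs) ∎
  where
  open ≤-Reasoning
  xs⊆as++bs : xs ⊆ as ++ bs
  xs⊆as++bs = ⊆∷∧∉⇒⊆ (⊆-respʳ-↭ (shift x as bs) (x∷xs⊆ys ∘ there)) (All¬⇒¬Any x∉xs)

record Edit {A : Set a} (k : ℕ) (xs ys : List A) : Set a where
  field
    kept removed added : List A
    xs↭removed++kept   : xs ↭ removed ++ kept
    ys↭added++kept     : ys ↭ added ++ kept
    |removed|≤k        : length removed ≤ k
    |added|≤k          : length added ≤ k

_∈[_,+_] : ℕ → ℕ → ℕ → Set
m ∈[ r ,+ k ] = r ≤ m × m ≤ k + r

m≤k+r∧r≤n⇒m∸n≤k : ∀ {m n r} k → m ≤ k + r → r ≤ n → m ∸ n ≤ k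
m≤k+r∧r≤n⇒m∸n≤k {r = r} k m≤k+r r≤n = ≤-trans (∸-mono m≤k+r r≤n) (≤-reflexive (m+n∸n≡m k r))

∣m-n∣≤-window : ∀ {m n r} k → m ∈[ r ,+ k ] → n ∈[ r ,+ k ] → ∣ + m - + n ∣ ≤ k
∣m-n∣≤-window {m} {n} k (r≤m , m≤k+r) (r≤n , n≤k+r)
  rewrite [+m]-[+n]≡m⊖n m n with ≤-total m n
... | inj₁ m≤n = subst (_≤ k) (sym (∣⊖∣-≤ m≤n)) (m≤k+r∧r≤n⇒m∸n≤k k n≤k+r r≤m)
... | inj₂ n≤m = subst (_≤ k) (sym (trans (∣m⊖n∣≡∣n⊖m∣ m n) (∣⊖∣-≤ n≤m))) (m≤k+r∧r≤n⇒m∸n≤k k m≤k+r r≤n)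

module Distinct {A : Set a} (_≟_ : DecidableEquality A) where

  distinct : List A → ℕ
  distinct xs = length (deduplicate _≟_ xs)

  distinct-mono-⊆ : {xs ys : List A} → xs ⊆ ys → distinct xs ≤ distinct ys
  distinct-mono-⊆ {xs} xs⊆ys =
    unique∧⊆⇒length≤ (deduplicate-! _≟_ xs)
      (Equivalence.to (deduplicate-∈⇔ _≟_) ∘ xs⊆ys ∘ Equivalence.from (deduplicate-∈⇔ _≟_))

  distinct-resp-↭ : {xs ys : List A} → xs ↭ ys → distinct xs ≡ distinct ys
  distinct-resp-↭ xs↭ys =
    ≤-antisym (distinct-mono-⊆ (⊆-reflexive-↭ xs↭ys))
              (distinct-mono-⊆ (⊆-reflexive-↭ (↭-sym xs↭ys)))

  distinct-∷-≤ : ∀ x xs → distinct (x ∷ xs) ≤ suc (distinct xs)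
  distinct-∷-≤ x xs = s≤s (length-filter _ (deduplicate _≟_ xs))

  distinct-++-≤ : ∀ xs ys → distinct (xs ++ ys) ≤ length xs + distinct ys
  distinct-++-≤ []       ys = ≤-refl
  distinct-++-≤ (x ∷ xs) ys = ≤-trans (distinct-∷-≤ x (xs ++ ys)) (s≤s (distinct-++-≤ xs ys))

  distinct-++-window : ∀ {k} xs ys → length xs ≤ k → distinct (xs ++ ys) ∈[ distinct ys ,+ k ]
  distinct-++-window xs ys |xs|≤k =
    distinct-mono-⊆ (xs⊆ys++xs ys xs) , ≤-trans (distinct-++-≤ xs ys) (+-monoˡ-≤ _ |xs|≤k)

  ∣distinct-distinct∣≤ : ∀ {k} {xs ys : List A} → Edit k xs ys → ∣ + distinct ys - + distinct xs ∣ ≤ k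
  ∣distinct-distinct∣≤ {k} e =
    ∣m-n∣≤-window k (window ys↭added++kept |added|≤k) (window xs↭removed++kept |removed|≤k)
    where
    open Edit e
    window : ∀ {zs pre} → zs ↭ pre ++ kept → length pre ≤ k → distinct zs ∈[ distinct kept ,+ k ]
    window {pre = pre} zs↭ |pre|≤k =
      subst (_∈[ distinct kept ,+ k ]) (sym (distinct-resp-↭ zs↭)) (distinct-++-window pre kept |pre|≤k)

open Distinct _≟_

dropZeros-++ : ∀ xs ys → dropZeros (xs ++ ys) ≡ dropZeros xs ++ dropZeros ys
dropZeros-++ []           ys = refl
dropZeros-++ (zero ∷ xs)  ys = dropZeros-++ xs ys
dropZeros-++ (suc x ∷ xs) ys = cong (suc x ∷_) (dropZeros-++ xs ys)

dropZeros-positive : ∀ {xs} → All Pos xs → dropZeros xs ≡ xs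
dropZeros-positive []                    = refl
dropZeros-positive {suc x ∷ _} (_ ∷ xs⁺) = cong (suc x ∷_) (dropZeros-positive xs⁺)

length-dropZeros : ∀ xs → length (dropZeros xs) ≤ length xs
length-dropZeros []           = z≤n
length-dropZeros (zero ∷ xs)  = m≤n⇒m≤1+n (length-dropZeros xs)
length-dropZeros (suc x ∷ xs) = s≤s (length-dropZeros xs)

replace-dropZeros⇒edit : ∀ {k xs ys} old new {rest} → All Pos xs →
                         xs ↭ old ++ rest → ys ↭ dropZeros (new ++ rest) →
                         length old ≤ k → length new ≤ k → Edit k xs ys
replace-dropZeros⇒edit old new {rest} xs⁺ xs↭ ys↭ |old|≤k |new|≤k = record
  { kept             = rest
  ; removed          = old
  ; added            = dropZeros new
  ; xs↭removed++kept = xs↭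
  ; ys↭added++kept   = subst (_ ↭_) dropZeros[new++rest]≡ ys↭
  ; |removed|≤k      = |old|≤k
  ; |added|≤k        = ≤-trans (length-dropZeros new) |new|≤k
  }
  where
  dropZeros[new++rest]≡ : dropZeros (new ++ rest) ≡ dropZeros new ++ rest
  dropZeros[new++rest]≡ = begin
    dropZeros (new ++ rest)           ≡⟨ dropZeros-++ new rest ⟩
    dropZeros new ++ dropZeros rest   ≡⟨ cong (dropZeros new ++_) (dropZeros-positive (++⁻ʳ old (All-resp-↭ xs↭ xs⁺))) ⟩
    dropZeros new ++ rest             ∎
    where open ≡-Reasoning

move⇒edit₂ : ∀ {xs ys} → All Pos xs → Move xs ys → Edit 2 xs ys
move⇒edit₂ xs⁺ (toExisting a b rest xs↭ ys↭) =
  replace-dropZeros⇒edit (a ∷ b ∷ []) (a ∸ 1 ∷ b + 1 ∷ []) xs⁺ xs↭ ys↭ ≤-refl ≤-refl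
move⇒edit₂ xs⁺ (toNew a rest xs↭ ys↭) =
  replace-dropZeros⇒edit (a ∷ []) (a ∸ 1 ∷ 1 ∷ []) xs⁺ xs↭ ys↭ (s≤s z≤n) ≤-refl

mainTheorem10 : (n : ℕ) → n ≥ 1 → (l m : Partition n) → Adj l m →
                ∣ (+ σ m) - (+ σ l) ∣ ≤ 2
mainTheorem10 _ _ l _ (_ , l⇝m) = ∣distinct-distinct∣≤ (move⇒edit₂ (pos l) l⇝m)
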